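{- Let $n,m$ be positive integers. (i) If $n>m$, then $b_{n+m}+b_{n-m}=2b_nC_m+C_m-1$; (ii) If $n\leq m$, then $b_{n+m}+b_{m-n+1}=2b_nC_m+C_m-1$.
   Context: The Lucas-balancing numbers $C_k$ ($k\ge0$) are defined by $C_0=1$, $C_1=3$, $C_{k+1}=6C_k-C_{k-1}$ for $k\ge1$. The cobalancing numbers $b_k$ ($k\ge1$) are defined by $b_1=0$, $b_2=2$, $b_{k+1}=6b_k-b_{k-1}+2$ for $k\ge2$. -}

module Defs where

open import Data.Nat using (ℕ; zero; suc)
open import Data.Integer using (ℤ; +_; _+_; _-_; _*_)

C : ℕ → ℤ
C zero = + 1
C (suc zero) = + 3
C (suc (suc k)) = + 6 * C (suc k) - C k

-- cob k = b_(k+1): b_1 = 0, b_2 = 2, b_(k+1) = 6 b_k - b_(k-1) + 2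
cob : ℕ → ℤ
cob zero = + 0
cob (suc zero) = + 2
cob (suc (suc k)) = + 6 * cob (suc k) - cob k + + 2

-- cobalancing numbers b_k for k ≥ 1; b 0 is a junk value (never used in the statement)
b : ℕ → ℤ
b zero = + 0
b (suc k) = cob k

module Submission where

-- Put  e k = 2 b_{k+1} + 1.  The cobalancing recurrence
-- b_{k+1} = 6 b_k − b_{k−1} + 2 becomes the homogeneous recurrence
-- e_{k+1} + e_{k−1} = 6 e_k, the same one satisfied by the Lucas-balancing
-- numbers.  Since e_1 = 5 = 6 e_0 − e_0, the sequence extends to all of ℤ
-- by the reflection e_{−1−k} = e_k and the recurrence keeps holding.
--
-- For ANY two-sided sequence x with x_{a+1} + x_{a−1} = 6 x_a we have the
-- addition formula  x_{a+m} + x_{a−m} = 2 C_m x_a  (induction on m, using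
-- C_{m+2} = 6 C_{m+1} − C_m).  Applied to e at a = n − 1 this gives (i) when
-- n > m, where a − m ≥ 0; when n ≤ m the index a − m is negative and the
-- reflection turns e_{a−m} into e_{m−n}, which gives (ii).  Finally the
-- identity for e is translated back to b by halving.

open import Defs
open import Data.Nat using (ℕ; zero; suc; _∸_; _>_; _≤_) renaming (_+_ to _+ℕ_)
open import Data.Integer using (ℤ; +_; -[1+_]; -_; _+_; _-_; _*_)
open import Data.Product using (_×_; _,_)
open import Relation.Binary.PropositionalEquality
open import Data.Integer.Tactic.RingSolver using (solve-∀)
import Data.Nat.Properties as ℕP
import Data.Integer.Properties as ℤP

Recurrent : (ℤ → ℤ) → Set
Recurrent x = ∀ a → x (a + + 1) + x (a - + 1) ≡ + 6 * x a

module AdditionFormula (x : ℤ → ℤ) (rec : Recurrent x) where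

  -- The recurrence at an index a, with the neighbouring indices given up to
  -- equality, so that ring identities on indices can be plugged in.
  recurrenceAt : ∀ a {u v} → u ≡ a + + 1 → v ≡ a - + 1 → x u + x v ≡ + 6 * x a
  recurrenceAt a refl refl = rec a

  combine : ∀ p q r s t u → p + t ≡ + 6 * r → u + q ≡ + 6 * s →
            p + q ≡ + 6 * (r + s) - (t + u)
  combine p q r s t u pt uq = begin
      p + q                          ≡⟨ regroup p q t u ⟩
      (p + t) + (u + q) - (t + u)    ≡⟨ cong₂ (λ v w → v + w - (t + u)) pt uq ⟩
      + 6 * r + + 6 * s - (t + u)    ≡⟨ cong (_- (t + u)) (sym (ℤP.*-distribˡ-+ (+ 6) r s)) ⟩
      + 6 * (r + s) - (t + u)        ∎
    where
    open ≡-Reasoning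
    regroup : ∀ p q t u → p + q ≡ (p + t) + (u + q) - (t + u)
    regroup = solve-∀

  addition : ∀ m a → x (a + + m) + x (a - + m) ≡ + 2 * C m * x a
  addition zero a = begin
      x (a + + 0) + x (a - + 0)   ≡⟨ cong₂ (λ u v → x u + x v) (ℤP.+-identityʳ a) (ℤP.+-identityʳ a) ⟩
      x a + x a                   ≡⟨ double (x a) ⟩
      + 2 * + 1 * x a             ∎
    where
    open ≡-Reasoning
    double : ∀ v → v + v ≡ + 2 * + 1 * v
    double = solve-∀
  addition (suc zero) a = rec a
  addition (suc (suc m)) a = begin
      x (a + + (2 +ℕ m)) + x (a - + (2 +ℕ m))
        ≡⟨ combine (above (2 +ℕ m)) (below (2 +ℕ m)) (above (1 +ℕ m)) (below (1 +ℕ m))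
                   (above m) (below m) upper lower ⟩
      + 6 * (x (a + + (1 +ℕ m)) + x (a - + (1 +ℕ m))) - (x (a + + m) + x (a - + m))
        ≡⟨ cong₂ (λ v w → + 6 * v - w) (addition (suc m) a) (addition m a) ⟩
      + 6 * (+ 2 * C (suc m) * x a) - + 2 * C m * x a
        ≡⟨ chebyshevStep (C (suc m)) (C m) (x a) ⟩
      + 2 * C (suc (suc m)) * x a
        ∎
    where
    open ≡-Reasoning
    above below : ℕ → ℤ
    above k = x (a + + k)
    below k = x (a - + k)
    -- The recurrence at a + (m + 1) and at a − (m + 1); the index identities
    -- are stated with k = + m, as + (suc m) is definitionally + 1 + + m.
    upper : x (a + + (2 +ℕ m)) + x (a + + m) ≡ + 6 * x (a + + (1 +ℕ m))
    upper = recurrenceAt (a + + (1 +ℕ m)) (up₁ a (+ m)) (up₂ a (+ m))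
      where
      up₁ : ∀ a k → a + (+ 2 + k) ≡ a + (+ 1 + k) + + 1
      up₁ = solve-∀
      up₂ : ∀ a k → a + k ≡ a + (+ 1 + k) - + 1
      up₂ = solve-∀
    lower : x (a - + m) + x (a - + (2 +ℕ m)) ≡ + 6 * x (a - + (1 +ℕ m))
    lower = recurrenceAt (a - + (1 +ℕ m)) (down₁ a (+ m)) (down₂ a (+ m))
      where
      down₁ : ∀ a k → a - k ≡ a - (+ 1 + k) + + 1
      down₁ = solve-∀
      down₂ : ∀ a k → a - (+ 2 + k) ≡ a - (+ 1 + k) - + 1
      down₂ = solve-∀
    chebyshevStep : ∀ c₁ c₀ v → + 6 * (+ 2 * c₁ * v) - + 2 * c₀ * v ≡ + 2 * (+ 6 * c₁ - c₀) * v
    chebyshevStep = solve-∀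

open AdditionFormula using (addition)

reflect : (ℕ → ℤ) → ℤ → ℤ
reflect x (+ k) = x k
reflect x -[1+ k ] = x k

-- The reflection is recurrent as soon as x is, provided x_1 + x_0 = 6 x_0,
-- i.e. the recurrence also holds at the junction index 0 (where x_{−1} = x_0).
reflect-recurrent : (x : ℕ → ℤ) →
  (∀ k → x (suc (suc k)) + x k ≡ + 6 * x (suc k)) →
  x 1 + x 0 ≡ + 6 * x 0 →
  Recurrent (reflect x)
reflect-recurrent x rec junction (+ zero) = junction
reflect-recurrent x rec junction (+ suc k) rewrite ℕP.+-comm k 1 = rec k
reflect-recurrent x rec junction -[1+ zero ] = trans (ℤP.+-comm (x 0) (x 1)) junction
reflect-recurrent x rec junction -[1+ suc k ] rewrite ℕP.+-identityʳ k =
  trans (ℤP.+-comm (x k) (x (suc (suc k)))) (rec k)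

oddCob : ℕ → ℤ
oddCob k = + 2 * cob k + + 1

oddCob-rec : ∀ k → oddCob (suc (suc k)) + oddCob k ≡ + 6 * oddCob (suc k)
oddCob-rec k = linearise (cob (suc k)) (cob k)
  where
  linearise : ∀ u v → (+ 2 * (+ 6 * u - v + + 2) + + 1) + (+ 2 * v + + 1) ≡ + 6 * (+ 2 * u + + 1)
  linearise = solve-∀

oddCob-recurrent : Recurrent (reflect oddCob)
oddCob-recurrent = reflect-recurrent oddCob oddCob-rec refl

halve : ∀ i j k c → oddCob i + oddCob j ≡ + 2 * c * oddCob k →
        cob i + cob j ≡ + 2 * cob k * c + c - + 1
halve i j k c h = ℤP.*-cancelˡ-≡ (+ 2) _ _ (begin
    + 2 * (cob i + cob j)                   ≡⟨ left (cob i) (cob j) ⟩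
    oddCob i + oddCob j - + 2               ≡⟨ cong (_- + 2) h ⟩
    + 2 * c * oddCob k - + 2                ≡⟨ right (cob k) c ⟩
    + 2 * (+ 2 * cob k * c + c - + 1)       ∎)
  where
  open ≡-Reasoning
  left : ∀ u v → + 2 * (u + v) ≡ (+ 2 * u + + 1) + (+ 2 * v + + 1) - + 2
  left = solve-∀
  right : ∀ u c → + 2 * c * (+ 2 * u + + 1) - + 2 ≡ + 2 * (+ 2 * u * c + c - + 1)
  right = solve-∀

-- Part (i) for n = m + 1 + o: the addition formula at a = m + o ≥ m.
part-i : ∀ n m → n > m → b (n +ℕ m) + b (n ∸ m) ≡ + 2 * b n * C m + C m - + 1
part-i n m m<n with ℕP.m≤n⇒∃[o]m+o≡n m<n
... | o , refl = subst (λ i → cob (m +ℕ o +ℕ m) + b i ≡ + 2 * cob (m +ℕ o) * C m + C m - + 1) (sym lowerIndex)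
  (halve (m +ℕ o +ℕ m) o (m +ℕ o) (C m) (begin
    oddCob (m +ℕ o +ℕ m) + oddCob o
      ≡⟨ cong (λ z → oddCob (m +ℕ o +ℕ m) + reflect oddCob z) (sym (cancel (+ m) (+ o))) ⟩
    oddCob (m +ℕ o +ℕ m) + reflect oddCob (+ m + + o - + m)
      ≡⟨ addition (reflect oddCob) oddCob-recurrent m (+ m + + o) ⟩
    + 2 * C m * oddCob (m +ℕ o) ∎))
  where
  open ≡-Reasoning
  cancel : ∀ u v → u + v - u ≡ v
  cancel = solve-∀
  lowerIndex : suc m +ℕ o ∸ m ≡ suc o
  lowerIndex = trans (cong (_∸ m) (sym (ℕP.+-suc m o))) (ℕP.m+n∸m≡n m (suc o))

-- Part (ii) for n = p + 1 and m = n + q: the addition formula at a = p < m,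
-- where the negative index p − m = −1 − q is reflected to q.
part-ii : ∀ n m → n > 0 → n ≤ m → b (n +ℕ m) + b ((m ∸ n) +ℕ 1) ≡ + 2 * b n * C m + C m - + 1
part-ii (suc p) m _ n≤m with ℕP.m≤n⇒∃[o]m+o≡n n≤m
... | q , refl = subst (λ i → cob (p +ℕ M) + b i ≡ + 2 * cob p * C M + C M - + 1) (sym lowerIndex)
  (halve (p +ℕ M) q p (C M) (begin
    oddCob (p +ℕ M) + oddCob q
      ≡⟨ cong (λ z → oddCob (p +ℕ M) + reflect oddCob z) (sym (overshoot (+ p) (+ q))) ⟩
    oddCob (p +ℕ M) + reflect oddCob (+ p - + M)
      ≡⟨ addition (reflect oddCob) oddCob-recurrent M (+ p) ⟩
    + 2 * C M * oddCob p ∎))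
  where
  open ≡-Reasoning
  M : ℕ
  M = suc p +ℕ q
  overshoot : ∀ u v → u - (+ 1 + u + v) ≡ - (+ 1 + v)
  overshoot = solve-∀
  lowerIndex : (M ∸ suc p) +ℕ 1 ≡ suc q
  lowerIndex = trans (cong (_+ℕ 1) (ℕP.m+n∸m≡n (suc p) q)) (ℕP.+-comm q 1)

mainTheorem7 : (n m : ℕ) → n > 0 → m > 0 →
    ((n > m → b (n +ℕ m) + b (n ∸ m) ≡ + 2 * b n * C m + C m - + 1)
    × (n ≤ m → b (n +ℕ m) + b ((m ∸ n) +ℕ 1) ≡ + 2 * b n * C m + C m - + 1))
mainTheorem7 n m n>0 _ = part-i n m , part-ii n m n>0
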